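{- Let $D$ be a digraph and $\mathfrak{S}=\{S_1,\dots,S_k\}$ a strong in-domatic partition of $V(D)$. Then: (a) $\bigcup_{i\in I}S_i$ is a strong in-dominating set of $D$ for every nonempty $I\subseteq\{1,\dots,k\}$; (b) for every nonempty $I\subseteq\{1,\dots,k\}$, $\mathfrak{S}_I=\{S_t: t\notin I\}\cup\{\bigcup_{t\in I}S_t\}$ is a strong in-domatic partition of $V(D)$; (c) for every $n\in\{1,\dots,\mathsf{d}_s^-(D)\}$ there is a strong in-domatic partition of $V(D)$ with exactly $n$ elements.
   Context: Digraphs are finite, loopless, without parallel arcs. A digraph is strong if for every ordered pair of vertices $u,v$ there is a directed $uv$-walk. $S\subseteq V(D)$ is in-dominating if every vertex not in $S$ has an out-neighbor in $S$; it is a strong in-dominating set if moreover the induced subdigraph $D\langle S\rangle$ is strong. A strong in-domatic partition is a partition of $V(D)$ into strong in-dominating sets; $\mathsf{d}_s^-(D)$ (the strong in-domatic number) is the maximum number of classes of a strong in-domatic partition of $D$. -}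

module Defs where

open import Level using (0ℓ)
open import Data.Nat using (ℕ; _≤_)
open import Data.Fin using (Fin)
open import Data.Fin.Subset as FS using (Subset)
open import Data.Product using (Σ; ∃; _×_; _,_)
open import Data.Sum using (_⊎_)
open import Data.Unit using (⊤)
open import Relation.Nullary using (¬_)
open import Relation.Unary using (Pred; _∈_; _∉_; _≐_; Satisfiable)
open import Relation.Binary.PropositionalEquality using (_≡_)

-- A finite loopless digraph on vertex set Fin n; arcs form a relation,
-- so there are no parallel arcs.
record Digraph : Set₁ where
  field
    n        : ℕ
    arc      : Fin n → Fin n → Set
    loopless : ∀ v → ¬ arc v v
open Digraph public

VSet : Digraph → Set₁
VSet D = Pred (Fin (n D)) 0ℓ

-- directed walks in the induced subdigraph D⟨S⟩ (all vertices after the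
-- first lie in S; the first vertex is required in S where used)
data WalkIn (D : Digraph) (S : VSet D) : Fin (n D) → Fin (n D) → Set where
  here : ∀ {v} → WalkIn D S v v
  step : ∀ {u w v} → arc D u w → w ∈ S → WalkIn D S w v → WalkIn D S u v

StrongInduced : (D : Digraph) → VSet D → Set
StrongInduced D S = ∀ u v → u ∈ S → v ∈ S → WalkIn D S u v

InDominating : (D : Digraph) → VSet D → Set
InDominating D S = ∀ v → v ∉ S → ∃ λ w → w ∈ S × arc D v w

StrongInDominating : (D : Digraph) → VSet D → Set
StrongInDominating D S = InDominating D S × StrongInduced D S

IsPartition : (D : Digraph) {k : ℕ} → (Fin k → VSet D) → Set
IsPartition D {k} S =
  (∀ i → Satisfiable (S i)) ×
  (∀ v → ∃ λ i → v ∈ S i) ×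
  (∀ v i j → v ∈ S i → v ∈ S j → i ≡ j)

IsStrongInDomaticPartition : (D : Digraph) {k : ℕ} → (Fin k → VSet D) → Set
IsStrongInDomaticPartition D S =
  IsPartition D S × (∀ i → StrongInDominating D (S i))

HasStrongInDomaticPartition : Digraph → ℕ → Set₁
HasStrongInDomaticPartition D k =
  Σ (Fin k → VSet D) (IsStrongInDomaticPartition D)

IsStrongInDomaticNumber : Digraph → ℕ → Set₁
IsStrongInDomaticNumber D d =
  HasStrongInDomaticPartition D d ×
  (∀ k → HasStrongInDomaticPartition D k → k ≤ d)

BigUnion : (D : Digraph) {k : ℕ} → (Fin k → VSet D) → Subset k → VSet D
BigUnion D S I v = ∃ λ i → i FS.∈ I × v ∈ S i

SameClasses : (D : Digraph) {A B : Set} → (A → VSet D) → (B → VSet D) → Set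
SameClasses D {A} {B} F G =
  (∀ a → ∃ λ b → F a ≐ G b) × (∀ b → ∃ λ a → G b ≐ F a)

Merged : (D : Digraph) {k : ℕ} → (Fin k → VSet D) → (I : Subset k) →
         (Σ (Fin k) (λ t → t FS.∉ I)) ⊎ ⊤ → VSet D
Merged D S I (Data.Sum.inj₁ (t , _)) = S t
Merged D S I (Data.Sum.inj₂ _) = BigUnion D S I

-- A vertex outside a strong in-dominating set T reaches every vertex of T by a
-- walk inside T: one arc into T, then strong connectivity of D⟨T⟩.  Hence the
-- union of disjoint strong in-dominating classes is again strong
-- in-dominating: from u ∈ Sᵢ to v ∈ Sⱼ, either i = j or u ∉ Sⱼ.  Merging the
-- classes indexed by I into their union therefore yields a strong in-domatic
-- partition, and merging two classes at a time lowers the number of classes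
-- one by one from d_s^-(D) down to 1.
module Submission where

open import Defs
open import Data.Nat using (ℕ; suc; _≤_; s≤s; _≤′_; ≤′-refl; ≤′-step)
open import Data.Nat.Properties using (≤⇒≤′)
open import Data.Fin using (Fin; zero; suc; _≟_)
open import Data.Fin.Properties using (suc-injective)
open import Data.Fin.Subset using (Subset; Nonempty; ⊥)
open import Data.Fin.Subset.Properties using (_∈?_; ∉⊥)
open import Data.Bool using (true)
open import Data.Vec using (_∷_; here; there)
open import Data.Product using (Σ; ∃; _×_; _,_; proj₁)
open import Data.Sum using (_⊎_; inj₁; inj₂)
open import Data.Unit using (tt)
open import Data.Empty using (⊥-elim)
open import Level using (Level)
open import Function.Definitions using (Injective)
open import Relation.Nullary using (yes; no; ¬?; contradiction)
open import Relation.Unary using (Pred; Decidable; Satisfiable; _∈_; _∉_; _⊆_; _≐_)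
open import Relation.Unary.Properties using (≐-refl)
open import Relation.Binary.PropositionalEquality using (_≡_; refl; cong; subst)

import Data.Fin.Subset as Subset

private
  variable
    ℓ : Level
    k : ℕ
    D : Digraph

WalkIn-mono : {T U : VSet D} → T ⊆ U → ∀ {u v} → WalkIn D T u v → WalkIn D U u v
WalkIn-mono T⊆U here             = here
WalkIn-mono T⊆U (step uw w∈T wv) = step uw (T⊆U w∈T) (WalkIn-mono T⊆U wv)

InDominating-⊇ : {T U : VSet D} → T ⊆ U → InDominating D T → InDominating D U
InDominating-⊇ T⊆U dom v v∉U with dom v (λ v∈T → v∉U (T⊆U v∈T))
... | w , w∈T , vw = w , T⊆U w∈T , vw

walkInto : {T : VSet D} → StrongInDominating D T →
           ∀ {u v} → u ∈ T ⊎ u ∉ T → v ∈ T → WalkIn D T u v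
walkInto (_   , strong) (inj₁ u∈T) v∈T = strong _ _ u∈T v∈T
walkInto (dom , strong) (inj₂ u∉T) v∈T with dom _ u∉T
... | w , w∈T , uw = step uw w∈T (strong w _ w∈T v∈T)

PairwiseDisjoint : (D : Digraph) → (Fin k → VSet D) → Set
PairwiseDisjoint D S = ∀ v i j → v ∈ S i → v ∈ S j → i ≡ j

module _ {S : Fin k → VSet D} (disjoint : PairwiseDisjoint D S) where

  ∈-or-∉ : ∀ {v i} → v ∈ S i → ∀ j → v ∈ S j ⊎ v ∉ S j
  ∈-or-∉ {i = i} v∈Sᵢ j with i ≟ j
  ... | yes refl = inj₁ v∈Sᵢ
  ... | no  i≢j  = inj₂ (λ v∈Sⱼ → i≢j (disjoint _ i j v∈Sᵢ v∈Sⱼ))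

  class⊆BigUnion : ∀ {I i} → i Subset.∈ I → S i ⊆ BigUnion D S I
  class⊆BigUnion {i = i} i∈I v∈Sᵢ = i , i∈I , v∈Sᵢ

  BigUnion-strongInDominating : (∀ i → StrongInDominating D (S i)) →
    (I : Subset k) → Nonempty I → StrongInDominating D (BigUnion D S I)
  BigUnion-strongInDominating sid I (i , i∈I) = dominating , strong
    where
    dominating : InDominating D (BigUnion D S I)
    dominating = InDominating-⊇ {D = D} (class⊆BigUnion i∈I) (proj₁ (sid i))

    strong : StrongInduced D (BigUnion D S I)
    strong u v (i , _ , u∈Sᵢ) (j , j∈I , v∈Sⱼ) =
      WalkIn-mono (class⊆BigUnion j∈I) (walkInto (sid j) (∈-or-∉ u∈Sᵢ j) v∈Sⱼ)

record Enumeration (P : Pred (Fin k) ℓ) : Set ℓ where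
  field
    size      : ℕ
    enum      : Fin size → Fin k
    enum-∈    : ∀ j → enum j ∈ P
    enum-onto : ∀ t → t ∈ P → ∃ λ j → enum j ≡ t
    enum-inj  : Injective _≡_ _≡_ enum

enumerate : {P : Pred (Fin k) ℓ} → Decidable P → Enumeration P
enumerate {k = 0} P? = record
  { size = 0 ; enum = λ () ; enum-∈ = λ () ; enum-onto = λ () ; enum-inj = λ {} }
enumerate {k = suc k} {P = P} P? with P? zero | enumerate {P = λ t → P (suc t)} (λ t → P? (suc t))
... | no ¬P0 | E = record
  { size      = size
  ; enum      = λ j → suc (enum j)
  ; enum-∈    = enum-∈
  ; enum-onto = onto
  ; enum-inj  = λ eq → enum-inj (suc-injective eq)
  }
  where
  open Enumeration E
  onto : ∀ t → t ∈ P → ∃ λ j → suc (enum j) ≡ t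
  onto zero    P0  = contradiction P0 ¬P0
  onto (suc t) Pt with enum-onto t Pt
  ... | j , refl = j , refl
... | yes P0 | E = record
  { size      = suc size
  ; enum      = enum′
  ; enum-∈    = λ { zero → P0 ; (suc j) → enum-∈ j }
  ; enum-onto = onto
  ; enum-inj  = inj
  }
  where
  open Enumeration E
  enum′ : Fin (suc size) → Fin (suc k)
  enum′ zero    = zero
  enum′ (suc j) = suc (enum j)
  onto : ∀ t → t ∈ P → ∃ λ j → enum′ j ≡ t
  onto zero    _  = zero , refl
  onto (suc t) Pt with enum-onto t Pt
  ... | j , refl = suc j , refl
  inj : Injective _≡_ _≡_ enum′
  inj {zero}  {zero}  _  = refl
  inj {suc i} {suc j} eq = cong suc (enum-inj (suc-injective eq))

module Merge {S : Fin k → VSet D} (I : Subset k) (rest : Enumeration (Subset._∉ I)) where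

  open Enumeration rest

  merged : Fin (suc size) → VSet D
  merged zero    = BigUnion D S I
  merged (suc j) = S (enum j)

  merged-isStrongInDomaticPartition : Nonempty I → IsStrongInDomaticPartition D S →
                                      IsStrongInDomaticPartition D merged
  merged-isStrongInDomaticPartition I≢∅@(i , i∈I) ((nonempty , covering , disjoint) , sid) =
    (nonempty′ , covering′ , disjoint′) , sid′
    where
    ∈I-∉rest : ∀ {v t} j → t Subset.∈ I → v ∈ S t → v ∉ S (enum j)
    ∈I-∉rest j t∈I v∈Sₜ v∈S = enum-∈ j (subst (Subset._∈ I) (disjoint _ _ _ v∈Sₜ v∈S) t∈I)

    nonempty′ : ∀ j → Satisfiable (merged j)
    nonempty′ zero    with nonempty i
    ... | v , v∈Sᵢ = v , i , i∈I , v∈Sᵢ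
    nonempty′ (suc j) = nonempty (enum j)

    covering′ : ∀ v → ∃ λ j → v ∈ merged j
    covering′ v with covering v
    ... | t , v∈Sₜ with t ∈? I
    ...   | yes t∈I = zero , t , t∈I , v∈Sₜ
    ...   | no  t∉I with enum-onto t t∉I
    ...     | j , refl = suc j , v∈Sₜ

    disjoint′ : PairwiseDisjoint D merged
    disjoint′ v zero    zero    _                _    = refl
    disjoint′ v zero    (suc j) (_ , t∈I , v∈Sₜ) v∈S  = ⊥-elim (∈I-∉rest j t∈I v∈Sₜ v∈S)
    disjoint′ v (suc j) zero    v∈S (_ , t∈I , v∈Sₜ)  = ⊥-elim (∈I-∉rest j t∈I v∈Sₜ v∈S)
    disjoint′ v (suc i) (suc j) v∈Sᵢ v∈Sⱼ = cong suc (enum-inj (disjoint v _ _ v∈Sᵢ v∈Sⱼ))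

    sid′ : ∀ j → StrongInDominating D (merged j)
    sid′ zero    = BigUnion-strongInDominating disjoint sid I I≢∅
    sid′ (suc j) = sid (enum j)

  merged-sameClasses : SameClasses D merged (Merged D S I)
  merged-sameClasses = forth , back
    where
    forth : ∀ j → ∃ λ c → merged j ≐ Merged D S I c
    forth zero    = inj₂ tt , ≐-refl
    forth (suc j) = inj₁ (enum j , enum-∈ j) , ≐-refl

    back : ∀ c → ∃ λ j → Merged D S I c ≐ merged j
    back (inj₂ tt)        = zero , ≐-refl
    back (inj₁ (t , t∉I)) with enum-onto t t∉I
    ... | j , refl = suc j , ≐-refl

firstTwo : Subset (suc (suc k))
firstTwo = true ∷ true ∷ ⊥

beyondFirstTwo : Enumeration (Subset._∉ firstTwo {k})
beyondFirstTwo = record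
  { size      = _
  ; enum      = λ j → suc (suc j)
  ; enum-∈    = λ { j (there (there j∈⊥)) → ∉⊥ j∈⊥ }
  ; enum-onto = onto
  ; enum-inj  = λ eq → suc-injective (suc-injective eq)
  }
  where
  onto : ∀ t → t Subset.∉ firstTwo → ∃ λ j → suc (suc j) ≡ t
  onto zero          t∉ = contradiction here t∉
  onto (suc zero)    t∉ = contradiction (there here) t∉
  onto (suc (suc j)) _  = j , refl

mergeFirstTwo : HasStrongInDomaticPartition D (suc (suc k)) →
                HasStrongInDomaticPartition D (suc k)
mergeFirstTwo (S , partition) = merged , merged-isStrongInDomaticPartition (zero , here) partition
  where open Merge firstTwo beyondFirstTwo

shrink : ∀ {m d} → m ≤′ d →
         HasStrongInDomaticPartition D (suc d) → HasStrongInDomaticPartition D (suc m)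
shrink ≤′-refl        P = P
shrink (≤′-step m≤′d) P = shrink m≤′d (mergeFirstTwo P)

proposition1 : (D : Digraph) (k : ℕ) (S : Fin k → VSet D) →
    IsStrongInDomaticPartition D S →
    ((I : Subset k) → Nonempty I → StrongInDominating D (BigUnion D S I)) ×
    ((I : Subset k) → Nonempty I →
      ∃ λ (m : ℕ) → Σ (Fin m → VSet D) λ S′ →
        IsStrongInDomaticPartition D S′ × SameClasses D S′ (Merged D S I)) ×
    ((d : ℕ) → IsStrongInDomaticNumber D d →
      (m : ℕ) → 1 ≤ m → m ≤ d → HasStrongInDomaticPartition D m)
proposition1 D k S partition@((_ , _ , disjoint) , sid) =
  BigUnion-strongInDominating disjoint sid , mergeClasses , fewerClasses
  where
  mergeClasses : (I : Subset k) → Nonempty I →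
    ∃ λ (m : ℕ) → Σ (Fin m → VSet D) λ S′ →
      IsStrongInDomaticPartition D S′ × SameClasses D S′ (Merged D S I)
  mergeClasses I I≢∅ =
    _ , merged , merged-isStrongInDomaticPartition I≢∅ partition , merged-sameClasses
    where open Merge I (enumerate (λ t → ¬? (t ∈? I)))

  fewerClasses : (d : ℕ) → IsStrongInDomaticNumber D d →
                 (m : ℕ) → 1 ≤ m → m ≤ d → HasStrongInDomaticPartition D m
  fewerClasses (suc d) (P , _) (suc m) _ (s≤s m≤d) = shrink (≤⇒≤′ m≤d) P
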